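{- Let $p$ be a prime, $r\ge1$ an integer, and $G_r=\mathbb Z/p^r\mathbb Z$. If $a\in G_r\setminus\{0\}$ and $p^{r-1}\mid a$, then $\kappa(G_r,a)=p^r-2$.
   Context: For a nontrivial finite abelian group $G$ written additively and $a\in G\setminus\{0\}$: if $G=\mathbb Z/2\mathbb Z$ then $\kappa(G,1)=0$; otherwise $\kappa(G,a)$ is the largest integer $k$ (possibly infinite in general) for which there exists a multiset $\langle a_1,\dots,a_k\rangle$ of elements of $G\setminus\{0\}$ such that $\sum_{j\in S}a_j\ne a$ for every subset $S\subseteq\{1,\dots,k\}$ (the empty sum being $0$). -}

module Defs where

open import Data.Nat using (ℕ; zero; suc; _+_; _*_; _≤_)
open import Data.Fin using (Fin; toℕ)
open import Data.Vec using (Vec; []; _∷_)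
open import Data.Bool using (Bool; true; false)
open import Data.Product using (Σ; ∃; _×_)
open import Relation.Binary.PropositionalEquality using (_≡_; _≢_)
open import Relation.Nullary using (¬_)
open import Data.Unit using (⊤)

-- The cyclic group ℤ/nℤ is represented by Fin n (canonical residues 0..n-1);
-- an element x is nonzero iff toℕ x ≢ 0.
-- A multiset of length k of elements of ℤ/nℤ is a Vec (Fin n) k (order irrelevant);
-- a subset S ⊆ {1..k} of indices is a Vec Bool k (true = index selected).

subsetSum : ∀ {n k} → Vec (Fin n) k → Vec Bool k → ℕ
subsetSum [] [] = 0
subsetSum (x ∷ xs) (true ∷ S) = toℕ x + subsetSum xs S
subsetSum (x ∷ xs) (false ∷ S) = subsetSum xs S

-- In ℤ/nℤ, the subset sum equals a  iff  the natural sum is ≡ toℕ a (mod n),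
-- i.e. (since 0 ≤ toℕ a < n) it equals toℕ a + q * n for some q.
SubsetSumIs : ∀ {n k} → Vec (Fin n) k → Vec Bool k → Fin n → Set
SubsetSumIs {n} xs S a = Σ ℕ (λ q → subsetSum xs S ≡ toℕ a + q * n)

AllNonzero : ∀ {n k} → Vec (Fin n) k → Set
AllNonzero [] = ⊤
AllNonzero (x ∷ xs) = (toℕ x ≢ 0) × AllNonzero xs

AvoidsSum : ∀ {n k} → Vec (Fin n) k → Fin n → Set
AvoidsSum {k = k} xs a = (S : Vec Bool k) → ¬ SubsetSumIs xs S a

Admissible : ∀ {n k} → Vec (Fin n) k → Fin n → Set
Admissible xs a = AllNonzero xs × AvoidsSum xs a

IsKappa : (n : ℕ) → Fin n → ℕ → Set
IsKappa n a k =
  (n ≡ 2 → k ≡ 0) ×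
  (n ≢ 2 →
     (Σ (Vec (Fin n) k) (λ xs → Admissible xs a)) ×
     ((m : ℕ) (xs : Vec (Fin n) m) → Admissible xs a → m ≤ k))

{-# OPTIONS --safe #-}
module Submission where

-- Let n = p ^ r and A = toℕ a. The A − 1 copies of 1 and n − 1 − A copies of −1 have subset
-- sums in the integer interval [A + 1 − n, A − 1], none of which is ≡ A (mod n); so κ ≥ n − 2.
-- Conversely, add the entries x of an admissible multiset one at a time, keeping a set of
-- reachable residues that contains 0 but not a. If adding x did not enlarge it, the set would be
-- closed under + x, hence contain every multiple of x. But gcd x n is a proper divisor of p ^ r,
-- so divides p ^ (r − 1) and therefore a: a is a multiple of x. So the set grows at every step,
-- and after k entries k + 1 ≤ n − 1.

open import Defs
open import Data.Nat using (ℕ; zero; suc; pred; _+_; _*_; _^_; _∸_; _≤_; _<_; s≤s; s≤s⁻¹; NonZero; >-nonZero; ≢-nonZero; _%_)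
open import Data.Nat.Properties
open import Data.Nat.DivMod using (_mod_; m%n<n; [m+kn]%n≡m%n; %-distribˡ-*; m≡m%n+[m/n]*n; m<n⇒m%n≡m; _/_)
open import Data.Nat.Divisibility using (_∣_; divides; _∣?_; ∣-trans; ∣⇒≤; ∣1⇒≡1; *-cancelʳ-∣; *-monoˡ-∣)
open import Data.Nat.GCD using (gcd; gcd[m,n]∣m; gcd[m,n]∣n; gcd-GCD; module Bézout)
open import Data.Nat.Coprimality using (Coprime; coprime-divisor)
open import Data.Nat.Primality using (Prime; prime⇒nonZero; prime⇒irreducible)
open import Data.Nat.Tactic.RingSolver using (solve-∀)
open import Function using (_∘′_)
open import Data.Fin using (Fin; toℕ; fromℕ) renaming (zero to fzero; suc to fsuc)
open import Data.Fin.Properties using (toℕ-injective; toℕ-fromℕ<; toℕ-fromℕ; toℕ<n; any?)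
open import Data.Fin.Subset using (Subset; _∈_; _∉_; ⁅_⁆; _∪_; ∣_∣; ⊤)
open import Data.Fin.Subset.Properties using (_∈?_; x∈⁅x⁆; x∈⁅y⁆⇒x≡y; ∣⁅x⁆∣≡1; p⊆p∪q; q⊆p∪q; x∈p∪q⁻; p⊂q⇒∣p∣<∣q∣; ∈⊤; ∣⊤∣≡n)
open import Data.Vec using (Vec; []; _∷_; replicate; _++_)
open import Data.Bool using (true; false)
open import Data.Product using (Σ; ∃-syntax; ∃₂; _×_; _,_)
open import Data.Sum using (inj₁; inj₂; [_,_])
open import Data.Unit using (tt)
open import Relation.Nullary using (¬_; yes; no; contradiction; ¬?; _×-dec_)
open import Relation.Nullary.Decidable using (decidable-stable)
open import Relation.Binary.PropositionalEquality using (_≡_; _≢_; refl; sym; trans; cong; cong₂; subst; module ≡-Reasoning)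

infix 4 _∈⟨_⟩[mod_]
_∈⟨_⟩[mod_] : ℕ → ℕ → (n : ℕ) .{{_ : NonZero n}} → Set
a ∈⟨ x ⟩[mod n ] = ∃[ c ] (c * x) % n ≡ a % n

gcd∈⟨⟩ : ∀ x n .{{_ : NonZero n}} → gcd x n ∈⟨ x ⟩[mod n ]
gcd∈⟨⟩ x n with Bézout.identity (gcd-GCD x n)
... | Bézout.+- X Y d+Yn≡Xx = X , (begin
  (X * x) % n           ≡⟨ cong (_% n) d+Yn≡Xx ⟨
  (gcd x n + Y * n) % n ≡⟨ [m+kn]%n≡m%n (gcd x n) Y n ⟩
  gcd x n % n           ∎)
  where open ≡-Reasoning
gcd∈⟨⟩ x n@(suc n-1) | Bézout.-+ X Y d+Xx≡Yn = n-1 * X , (begin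
  (n-1 * X * x) % n               ≡⟨ [m+kn]%n≡m%n (n-1 * X * x) d n ⟨
  (n-1 * X * x + d * n) % n       ≡⟨ cong (_% n) shift ⟩
  (d + (n-1 * Y) * n) % n         ≡⟨ [m+kn]%n≡m%n d (n-1 * Y) n ⟩
  d % n                           ∎)
  where
  open ≡-Reasoning
  d : ℕ
  d = gcd x n
  -- n − 1 ≡ −1 (mod n), so multiplying d + X x ≡ Y n by n − 1 gives (n − 1) X x ≡ d (mod n)
  shift : n-1 * X * x + d * n ≡ d + (n-1 * Y) * n
  shift = begin
    n-1 * X * x + d * n     ≡⟨ expand n-1 X x d ⟩
    d + n-1 * (d + X * x)   ≡⟨ cong (λ t → d + n-1 * t) d+Xx≡Yn ⟩
    d + n-1 * (Y * n)       ≡⟨ cong (d +_) (*-assoc n-1 Y n) ⟨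
    d + (n-1 * Y) * n       ∎
    where
    expand : ∀ m X x d → m * X * x + d * suc m ≡ d + m * (d + X * x)
    expand = solve-∀

∈⟨⟩-*ˡ : ∀ e {a x n} .{{_ : NonZero n}} → a ∈⟨ x ⟩[mod n ] → e * a ∈⟨ x ⟩[mod n ]
∈⟨⟩-*ˡ e {a} {x} {n} (c , cx≡a) = e * c , (begin
  (e * c * x) % n               ≡⟨ cong (_% n) (*-assoc e c x) ⟩
  (e * (c * x)) % n             ≡⟨ %-distribˡ-* e (c * x) n ⟩
  ((e % n) * ((c * x) % n)) % n ≡⟨ cong (λ t → ((e % n) * t) % n) cx≡a ⟩
  ((e % n) * (a % n)) % n       ≡⟨ %-distribˡ-* e a n ⟨
  (e * a) % n                   ∎)
  where open ≡-Reasoning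

gcd∣⇒∈⟨⟩ : ∀ {a x n} .{{_ : NonZero n}} → gcd x n ∣ a → a ∈⟨ x ⟩[mod n ]
gcd∣⇒∈⟨⟩ {x = x} {n} (divides e refl) = ∈⟨⟩-*ˡ e (gcd∈⟨⟩ x n)

module _ {p : ℕ} (p-prime : Prime p) where

  private instance
    p≢0 : NonZero p
    p≢0 = prime⇒nonZero p-prime

  ∤⇒coprime : ∀ {d} → ¬ p ∣ d → Coprime d p
  ∤⇒coprime p∤d (i∣d , i∣p) with prime⇒irreducible p-prime i∣p
  ... | inj₁ i≡1 = i≡1
  ... | inj₂ refl = contradiction i∣d p∤d

  ∣p^[1+r]∧≢⇒∣p^r : ∀ r {d} → d ∣ p ^ suc r → d ≢ p ^ suc r → d ∣ p ^ r
  ∣p^r∧≢⇒*p∣p^r   : ∀ r {e} → e ∣ p ^ r → e ≢ p ^ r → e * p ∣ p ^ r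

  ∣p^[1+r]∧≢⇒∣p^r r {d} d∣p^[1+r] d≢p^[1+r] with p ∣? d
  ... | no p∤d = coprime-divisor (∤⇒coprime p∤d) d∣p^[1+r]
  ... | yes (divides e refl) = ∣p^r∧≢⇒*p∣p^r r e∣p^r e≢p^r
    where
    e∣p^r : e ∣ p ^ r
    e∣p^r = *-cancelʳ-∣ p (subst (e * p ∣_) (*-comm p (p ^ r)) d∣p^[1+r])
    e≢p^r : e ≢ p ^ r
    e≢p^r e≡p^r = d≢p^[1+r] (trans (cong (_* p) e≡p^r) (*-comm (p ^ r) p))

  ∣p^r∧≢⇒*p∣p^r zero    {e} e∣1 e≢1 = contradiction (∣1⇒≡1 e∣1) e≢1
  ∣p^r∧≢⇒*p∣p^r (suc r) {e} e∣p^[1+r] e≢p^[1+r] =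
    subst (e * p ∣_) (*-comm (p ^ r) p) (*-monoˡ-∣ p (∣p^[1+r]∧≢⇒∣p^r r e∣p^[1+r] e≢p^[1+r]))

  p^r∣⇒∈⟨⟩ : ∀ r {a x} .{{_ : NonZero (p ^ suc r)}} →
             0 < x → x < p ^ suc r → p ^ r ∣ a → a ∈⟨ x ⟩[mod p ^ suc r ]
  p^r∣⇒∈⟨⟩ r {x = x} 0<x x<p^[1+r] p^r∣a = gcd∣⇒∈⟨⟩ {x = x} (∣-trans gcd∣p^r p^r∣a)
    where
    gcd≤x : gcd x (p ^ suc r) ≤ x
    gcd≤x = ∣⇒≤ {{>-nonZero 0<x}} (gcd[m,n]∣m x (p ^ suc r))
    gcd∣p^r : gcd x (p ^ suc r) ∣ p ^ r
    gcd∣p^r = ∣p^[1+r]∧≢⇒∣p^r r (gcd[m,n]∣n x (p ^ suc r))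
      λ gcd≡p^[1+r] → <⇒≱ x<p^[1+r] (subst (_≤ x) gcd≡p^[1+r] gcd≤x)

module _ {n : ℕ} .{{_ : NonZero n}} where

  infixl 6 _⊕_
  _⊕_ : Fin n → Fin n → Fin n
  x ⊕ i = (toℕ x + toℕ i) mod n

  toℕ-mod : ∀ m → toℕ (m mod n) ≡ m % n
  toℕ-mod m = toℕ-fromℕ< (m%n<n m n)

  ⊕-mod : ∀ x m → x ⊕ m mod n ≡ (toℕ x + m) mod n
  ⊕-mod x m = toℕ-injective (begin
    toℕ (x ⊕ m mod n)                   ≡⟨ toℕ-mod _ ⟩
    (toℕ x + toℕ (m mod n)) % n         ≡⟨ cong (λ t → (toℕ x + t) % n) (toℕ-mod m) ⟩
    (toℕ x + m % n) % n                 ≡⟨ [m+kn]%n≡m%n (toℕ x + m % n) (m / n) n ⟨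
    (toℕ x + m % n + m / n * n) % n     ≡⟨ cong (_% n) (+-assoc (toℕ x) (m % n) (m / n * n)) ⟩
    (toℕ x + (m % n + m / n * n)) % n   ≡⟨ cong (λ t → (toℕ x + t) % n) (m≡m%n+[m/n]*n m n) ⟨
    (toℕ x + m) % n                     ≡⟨ toℕ-mod _ ⟨
    toℕ ((toℕ x + m) mod n)             ∎)
    where open ≡-Reasoning

  closed⇒multiples∈ : ∀ {L : Subset n} {x} → 0 mod n ∈ L → (∀ {i} → i ∈ L → x ⊕ i ∈ L) →
                      ∀ c → (c * toℕ x) mod n ∈ L
  closed⇒multiples∈ 0∈L closed zero = 0∈L
  closed⇒multiples∈ {L} {x} 0∈L closed (suc c) =
    subst (_∈ L) (⊕-mod x (c * toℕ x)) (closed (closed⇒multiples∈ 0∈L closed c))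

  ∈⟨⟩⇒multiple≡ : ∀ {a x : Fin n} → toℕ a ∈⟨ toℕ x ⟩[mod n ] → ∃[ c ] (c * toℕ x) mod n ≡ a
  ∈⟨⟩⇒multiple≡ {a} (c , cx≡a) =
    c , toℕ-injective (trans (toℕ-mod _) (trans cx≡a (m<n⇒m%n≡m (toℕ<n a))))

  ∈⟨⟩∧∉⇒escapes : ∀ {L : Subset n} {a x} → 0 mod n ∈ L → a ∉ L → toℕ a ∈⟨ toℕ x ⟩[mod n ] →
                  ∃[ i ] i ∈ L × x ⊕ i ∉ L
  ∈⟨⟩∧∉⇒escapes {L} {a} {x} 0∈L a∉L a∈⟨x⟩ with any? (λ i → i ∈? L ×-dec ¬? (x ⊕ i ∈? L))
  ... | yes escape = escape
  ... | no no-escape with ∈⟨⟩⇒multiple≡ a∈⟨x⟩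
  ...   | c , cx≡a = contradiction (subst (_∈ L) cx≡a (closed⇒multiples∈ 0∈L closed c)) a∉L
    where
    closed : ∀ {i} → i ∈ L → x ⊕ i ∈ L
    closed {i} i∈L = decidable-stable (x ⊕ i ∈? L) (λ x⊕i∉L → no-escape (i , i∈L , x⊕i∉L))

  Reachable : ∀ {k} → Vec (Fin n) k → Fin n → Set
  Reachable {k} xs i = ∃[ S ] subsetSum xs S mod n ≡ i

  reachable-[] : Reachable [] (0 mod n)
  reachable-[] = [] , refl

  reachable-skip : ∀ {k} {xs : Vec (Fin n) k} {i} x → Reachable xs i → Reachable (x ∷ xs) i
  reachable-skip x (S , sum≡i) = false ∷ S , sum≡i

  reachable-take : ∀ {k} {xs : Vec (Fin n) k} {i} x → Reachable xs i → Reachable (x ∷ xs) (x ⊕ i)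
  reachable-take x (S , sum≡i) = true ∷ S , trans (sym (⊕-mod x _)) (cong (x ⊕_) sum≡i)

  avoids⇒unreachable : ∀ {k} {xs : Vec (Fin n) k} {a} → AvoidsSum xs a → ¬ Reachable xs a
  avoids⇒unreachable {xs = xs} {a} avoids (S , sum≡a) = avoids S (subsetSum xs S / n , (begin
    subsetSum xs S                              ≡⟨ m≡m%n+[m/n]*n (subsetSum xs S) n ⟩
    subsetSum xs S % n + subsetSum xs S / n * n ≡⟨ cong (_+ subsetSum xs S / n * n) (trans (sym (toℕ-mod _)) (cong toℕ sum≡a)) ⟩
    toℕ a + subsetSum xs S / n * n              ∎))
    where open ≡-Reasoning

  record ReachableResidues {k} (xs : Vec (Fin n) k) : Set where
    field
      residues  : Subset n
      reachable : ∀ {i} → i ∈ residues → Reachable xs i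
      zero∈     : 0 mod n ∈ residues
      many      : suc k ≤ ∣ residues ∣

  module _ (a : Fin n) (generates : ∀ (x : Fin n) → toℕ x ≢ 0 → toℕ a ∈⟨ toℕ x ⟩[mod n ]) where

    extend : ∀ {k} {xs : Vec (Fin n) k} x → toℕ x ≢ 0 → ¬ Reachable xs a →
             ReachableResidues xs → ReachableResidues (x ∷ xs)
    extend {xs = xs} x x≢0 a-unreachable R
      with ∈⟨⟩∧∉⇒escapes zero∈ (a-unreachable ∘′ reachable) (generates x x≢0)
      where open ReachableResidues R
    ... | i , i∈ , x⊕i∉ = record
      { residues  = residues ∪ ⁅ x ⊕ i ⁆
      ; reachable = [ reachable-skip x ∘′ reachable , reachable-new ] ∘′ x∈p∪q⁻ residues ⁅ x ⊕ i ⁆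
      ; zero∈     = p⊆p∪q ⁅ x ⊕ i ⁆ zero∈
      ; many      = ≤-trans (s≤s many)
                      (p⊂q⇒∣p∣<∣q∣ (p⊆p∪q ⁅ x ⊕ i ⁆ , x ⊕ i , q⊆p∪q residues _ (x∈⁅x⁆ _) , x⊕i∉))
      }
      where
      open ReachableResidues R
      reachable-new : ∀ {j} → j ∈ ⁅ x ⊕ i ⁆ → Reachable (x ∷ xs) j
      reachable-new j∈ rewrite x∈⁅y⁆⇒x≡y _ j∈ = reachable-take x (reachable i∈)

    reachableResidues : ∀ {k} (xs : Vec (Fin n) k) → Admissible xs a → ReachableResidues xs
    reachableResidues [] _ = record
      { residues  = ⁅ 0 mod n ⁆
      ; reachable = λ i∈ → subst (Reachable []) (sym (x∈⁅y⁆⇒x≡y _ i∈)) reachable-[]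
      ; zero∈     = x∈⁅x⁆ _
      ; many      = ≤-reflexive (sym (∣⁅x⁆∣≡1 (0 mod n)))
      }
    reachableResidues (x ∷ xs) ((x≢0 , nonzero) , avoids) =
      extend x x≢0 (avoids⇒unreachable {xs = xs} avoids′) (reachableResidues xs (nonzero , avoids′))
      where
      avoids′ : AvoidsSum xs a
      avoids′ S = avoids (false ∷ S)

    admissible⇒≤n∸2 : ∀ {k} (xs : Vec (Fin n) k) → Admissible xs a → k ≤ n ∸ 2
    admissible⇒≤n∸2 {k} xs adm@(_ , avoids) = ∸-monoˡ-≤ 2 (begin
      suc (suc k)      ≤⟨ s≤s many ⟩
      suc ∣ residues ∣ ≤⟨ p⊂q⇒∣p∣<∣q∣ ((λ _ → ∈⊤) , a , ∈⊤ , avoids⇒unreachable {xs = xs} avoids ∘′ reachable) ⟩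
      ∣ ⊤ {n} ∣        ≡⟨ ∣⊤∣≡n n ⟩
      n                ∎)
      where
      open ≤-Reasoning
      open ReachableResidues (reachableResidues xs adm)

AllNonzero-replicate : ∀ {n} j {y : Fin n} → toℕ y ≢ 0 → AllNonzero (replicate j y)
AllNonzero-replicate zero    y≢0 = tt
AllNonzero-replicate (suc j) y≢0 = y≢0 , AllNonzero-replicate j y≢0

AllNonzero-++ : ∀ {n i j} (xs : Vec (Fin n) i) {ys : Vec (Fin n) j} →
                AllNonzero xs → AllNonzero ys → AllNonzero (xs ++ ys)
AllNonzero-++ []       _                ys≢0 = ys≢0
AllNonzero-++ (x ∷ xs) (x≢0 , xs≢0) ys≢0 = x≢0 , AllNonzero-++ xs xs≢0 ys≢0

subsetSum-replicate : ∀ {n} j (y : Fin n) S → ∃[ v ] v ≤ j × subsetSum (replicate j y) S ≡ v * toℕ y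
subsetSum-replicate zero    y []          = 0 , ≤-refl , refl
subsetSum-replicate (suc j) y (true ∷ S)  with subsetSum-replicate j y S
... | v , v≤j , sum≡ = suc v , s≤s v≤j , cong (toℕ y +_) sum≡
subsetSum-replicate (suc j) y (false ∷ S) with subsetSum-replicate j y S
... | v , v≤j , sum≡ = v , m≤n⇒m≤1+n v≤j , sum≡

subsetSum-++ : ∀ {n i j} (xs : Vec (Fin n) i) (ys : Vec (Fin n) j) S →
               ∃₂ λ S₁ S₂ → subsetSum (xs ++ ys) S ≡ subsetSum xs S₁ + subsetSum ys S₂
subsetSum-++ []       ys S           = [] , S , refl
subsetSum-++ (x ∷ xs) ys (true ∷ S)  with subsetSum-++ xs ys S
... | S₁ , S₂ , sum≡ = true ∷ S₁ , S₂ , trans (cong (toℕ x +_) sum≡) (sym (+-assoc (toℕ x) _ _))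
subsetSum-++ (x ∷ xs) ys (false ∷ S) with subsetSum-++ xs ys S
... | S₁ , S₂ , sum≡ = false ∷ S₁ , S₂ , sum≡

m+kn≡o+ln⇒m≡o : ∀ {m o n} k l .{{_ : NonZero n}} → m < n → o < n → m + k * n ≡ o + l * n → m ≡ o
m+kn≡o+ln⇒m≡o {m} {o} {n} k l m<n o<n eq = begin
  m               ≡⟨ m<n⇒m%n≡m m<n ⟨
  m % n           ≡⟨ [m+kn]%n≡m%n m k n ⟨
  (m + k * n) % n ≡⟨ cong (_% n) eq ⟩
  (o + l * n) % n ≡⟨ [m+kn]%n≡m%n o l n ⟩
  o % n           ≡⟨ m<n⇒m%n≡m o<n ⟩
  o               ∎
  where open ≡-Reasoning

module _ (m : ℕ) where

  private
    N : ℕ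
    N = suc (suc m)

    1ₙ -1ₙ : Fin N
    1ₙ  = fsuc fzero
    -1ₙ = fromℕ (suc m)

    -1ₙ≢0 : toℕ -1ₙ ≢ 0
    -1ₙ≢0 -1ₙ≡0 = 0≢1+n (trans (sym -1ₙ≡0) (toℕ-fromℕ (suc m)))

  onesAndMinusOnes : ∀ b → Vec (Fin N) (b + (m ∸ b))
  onesAndMinusOnes b = replicate b 1ₙ ++ replicate (m ∸ b) -1ₙ

  subsetSum-onesAndMinusOnes : ∀ b S → ∃₂ λ u v → u ≤ b × v ≤ m ∸ b ×
                               subsetSum (onesAndMinusOnes b) S ≡ u + v * suc m
  subsetSum-onesAndMinusOnes b S
    with subsetSum-++ (replicate b 1ₙ) (replicate (m ∸ b) -1ₙ) S
  ... | S₁ , S₂ , sum≡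
    with subsetSum-replicate b 1ₙ S₁ | subsetSum-replicate (m ∸ b) -1ₙ S₂
  ... | u , u≤b , sum₁≡ | v , v≤m∸b , sum₂≡ = u , v , u≤b , v≤m∸b , (begin
    subsetSum (onesAndMinusOnes b) S                                     ≡⟨ sum≡ ⟩
    subsetSum (replicate b 1ₙ) S₁ + subsetSum (replicate (m ∸ b) -1ₙ) S₂ ≡⟨ cong₂ _+_ sum₁≡ sum₂≡ ⟩
    u * 1 + v * toℕ -1ₙ                                                  ≡⟨ cong₂ _+_ (*-identityʳ u) (cong (v *_) (toℕ-fromℕ (suc m))) ⟩
    u + v * suc m                                                        ∎)
    where open ≡-Reasoning

  onesAndMinusOnes-avoids : ∀ b (a : Fin N) → toℕ a ≡ suc b → b ≤ m → AvoidsSum (onesAndMinusOnes b) a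
  onesAndMinusOnes-avoids b a a≡1+b b≤m S (q , sum≡a+qN) with subsetSum-onesAndMinusOnes b S
  ... | u , v , u≤b , v≤m∸b , sum≡u+v[N-1] = <⇒≱ u<1+b+v (≤-reflexive (sym u≡1+b+v))
    where
    open ≡-Reasoning
    1+b+v<N : suc b + v < N
    1+b+v<N = s≤s (≤-trans (+-monoʳ-≤ (suc b) v≤m∸b) (≤-reflexive (cong suc (m+[n∸m]≡n b≤m))))
    u<1+b+v : u < suc b + v
    u<1+b+v = s≤s (≤-trans u≤b (m≤m+n b v))
    sums : u + v * N ≡ suc b + v + q * N
    sums = begin
      u + v * N         ≡⟨ regroup u v m ⟩
      u + v * suc m + v ≡⟨ cong (_+ v) (trans (sym sum≡u+v[N-1]) (trans sum≡a+qN (cong (_+ q * N) a≡1+b))) ⟩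
      suc b + q * N + v ≡⟨ swap (suc b) q N v ⟩
      suc b + v + q * N ∎
      where
      regroup : ∀ u v m → u + v * suc (suc m) ≡ u + v * suc m + v
      regroup = solve-∀
      swap : ∀ c q N v → c + q * N + v ≡ c + v + q * N
      swap = solve-∀
    u≡1+b+v : u ≡ suc b + v
    u≡1+b+v = m+kn≡o+ln⇒m≡o v q (<-trans u<1+b+v 1+b+v<N) 1+b+v<N sums

  admissible-of-size-n∸2 : (a : Fin N) → toℕ a ≢ 0 → Σ (Vec (Fin N) m) (λ xs → Admissible xs a)
  admissible-of-size-n∸2 a a≢0 =
    subst (λ k → Σ (Vec (Fin N) k) (λ xs → Admissible xs a)) (m+[n∸m]≡n b≤m)
      ( onesAndMinusOnes b
      , AllNonzero-++ (replicate b 1ₙ) (AllNonzero-replicate b λ ()) (AllNonzero-replicate (m ∸ b) -1ₙ≢0)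
      , onesAndMinusOnes-avoids b a a≡1+b b≤m )
    where
    b : ℕ
    b = pred (toℕ a)
    a≡1+b : toℕ a ≡ suc b
    a≡1+b = sym (suc-pred (toℕ a) {{≢-nonZero a≢0}})
    b≤m : b ≤ m
    b≤m = s≤s⁻¹ (s≤s⁻¹ (subst (_< N) a≡1+b (toℕ<n a)))

κ≡n∸2 : ∀ n .{{_ : NonZero n}} (a : Fin n) → toℕ a ≢ 0 →
        (∀ (x : Fin n) → toℕ x ≢ 0 → toℕ a ∈⟨ toℕ x ⟩[mod n ]) → IsKappa n a (n ∸ 2)
κ≡n∸2 (suc zero)    fzero a≢0 _         = contradiction refl a≢0
κ≡n∸2 (suc (suc m)) a     a≢0 generates =
  (λ n≡2 → suc-injective (suc-injective n≡2)) ,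
  (λ _ → admissible-of-size-n∸2 m a a≢0 , λ _ xs → admissible⇒≤n∸2 a generates xs)

lemma2 : (p r : ℕ) → Prime p → 1 ≤ r → (a : Fin (p ^ r)) → toℕ a ≢ 0 →
           p ^ (r ∸ 1) ∣ toℕ a → IsKappa (p ^ r) a (p ^ r ∸ 2)
lemma2 p zero    _       ()
lemma2 p (suc r) p-prime _ a a≢0 p^r∣a =
  κ≡n∸2 (p ^ suc r) a a≢0 λ x x≢0 → p^r∣⇒∈⟨⟩ p-prime r (n≢0⇒n>0 x≢0) (toℕ<n x) p^r∣a
  where
  instance
    p^[1+r]≢0 : NonZero (p ^ suc r)
    p^[1+r]≢0 = m^n≢0 p (suc r) {{prime⇒nonZero p-prime}}
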